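{- Let $k=p_1^{a_1}p_2^{a_2}\cdots p_n^{a_n}$ be a positive integer with $p_1,\dots,p_n$ distinct primes and $a_i\ge 1$. Then $k\in E_3^*$ if and only if $\gcd(a_1,a_2,\dots,a_n)\in G_3^*$.
   Context: An exponential progression is a triple $x, x^n, x^{n^2}$ with $x,n$ natural numbers greater than $1$. $E_3^*$ is the greedy set of positive integers free of exponential progressions: going through $1,2,3,\dots$ in order, each integer is included unless it is the largest term of an exponential progression whose two smaller terms are already included (so $1\in E_3^*$). A three-term geometric progression is a triple $a, na, n^2a$ with $a$ a positive integer and $n>1$ an integer; $G_3^*$ is the greedy set of positive integers free of three-term geometric progressions, built in the same way (each integer in increasing order is included unless it is the largest term of a geometric progression whose two smaller terms are already included). For $k=1$ (empty factorization) the statement is read with $1\in E_3^*$. -}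

module Defs where

open import Data.Bool using (Bool; true; false; _∧_; not; if_then_else_; T)
open import Data.Nat using (ℕ; zero; suc; _*_; _^_; _≡ᵇ_; _≤ᵇ_)
open import Data.Nat.GCD using (gcd)
open import Data.List using (List; upTo)
open import Data.Bool.ListAction using (any)
open import Data.Fin using (Fin; zero; suc)

-- Given the membership function f of the greedy set on all integers < k,
-- decide whether k is the largest term of an exponential progression
-- x, x^n, x^(n^2) (x, n ≥ 2) whose two smaller terms are in the set.
-- (Any such x, n satisfy x ≤ k and n ≤ k, so the bounded search is exhaustive;
--  moreover x < x^n < k, so f is only consulted below k.)
expBlocked : (ℕ → Bool) → ℕ → Bool
expBlocked f k =
  any (λ x → any (λ n →
        (2 ≤ᵇ x) ∧ (2 ≤ᵇ n) ∧ (x ^ (n * n) ≡ᵇ k) ∧ f x ∧ f (x ^ n))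
      (upTo (suc k)))
    (upTo (suc k))

-- Same for three-term geometric progressions a, n a, n^2 a (a ≥ 1, n ≥ 2).
-- (Any such a, n satisfy a ≤ k and n ≤ k; a < n a < k.)
geoBlocked : (ℕ → Bool) → ℕ → Bool
geoBlocked f k =
  any (λ a → any (λ n →
        (1 ≤ᵇ a) ∧ (2 ≤ᵇ n) ∧ (n * n * a ≡ᵇ k) ∧ f a ∧ f (n * a))
      (upTo (suc k)))
    (upTo (suc k))

-- Greedy construction: 'greedy blocked k' is the characteristic function of
-- the greedy set, correct on all arguments < k (and false from k on).
greedy : ((ℕ → Bool) → ℕ → Bool) → ℕ → (ℕ → Bool)
greedy blocked zero = λ _ → false
greedy blocked (suc k) =
  let f = greedy blocked k in
  λ i → if i ≡ᵇ k then (1 ≤ᵇ k) ∧ not (blocked f k) else f i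

inE : ℕ → Bool
inE m = greedy expBlocked (suc m) m

inG : ℕ → Bool
inG m = greedy geoBlocked (suc m) m

_∈E₃* : ℕ → Set
m ∈E₃* = T (inE m)

_∈G₃* : ℕ → Set
m ∈G₃* = T (inG m)

prodFin : (n : ℕ) → (Fin n → ℕ) → ℕ
prodFin zero f = 1
prodFin (suc n) f = f zero * prodFin n (λ i → f (suc i))

gcdFin : (n : ℕ) → (Fin n → ℕ) → ℕ
gcdFin zero f = 0
gcdFin (suc n) f = gcd (f zero) (gcdFin n (λ i → f (suc i)))

{-# OPTIONS --safe #-}
module Submission where

-- Write g = gcd aᵢ and aᵢ = g bᵢ, so that gcd bᵢ = 1, and put K e = ∏ pᵢ^(bᵢ e); then k = K g.
-- Because the bᵢ are coprime, x^N = K e forces N ∣ e and x = K (e / N) (compare the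
-- pᵢ-adic valuations). Hence the exponential progressions x, x^n, x^(n²) ending in K e are
-- exactly the images K c, K (n c), K (n² c) of the geometric progressions c, n c, n² c
-- ending in e, and strong induction on e shows that the two greedy constructions agree
-- along K: K e ∈ E₃* iff e ∈ G₃*.

open import Defs
open import Data.Bool using (Bool; true; false; _∧_; not; T)
open import Data.Bool.ListAction using (any)
open import Data.Bool.Properties using (T-∧; T-not-≡; T-≡)
open import Data.Empty using (⊥-elim)
open import Data.Fin using (Fin; zero; suc)
open import Data.Fin.Properties using () renaming (0≢1+n to Fin-0≢1+n; suc-injective to Fin-suc-injective)
open import Data.List using (upTo)
open import Data.List.Membership.Propositional using (find; lose)
open import Data.List.Membership.Propositional.Properties using (∈-upTo⁺; ∈-upTo⁻)
open import Data.List.Relation.Unary.Any.Properties using (any⁺; any⁻)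
open import Data.Nat using (ℕ; zero; suc; NonZero; _*_; _^_; _≡ᵇ_; _≤_; _<_; z≤n; s≤s; s≤s⁻¹; z<s; >-nonZero; >-nonZero⁻¹; nonTrivial⇒n>1)
open import Data.Nat.Divisibility using (_∣_; module _∣_; _∤_; divides; quotient; _∣?_; ∣-trans; _∣0; 0∣⇒≡0; ∣1⇒≡1; m∣m*n; ∣m⇒∣m*n)
open import Data.Nat.GCD using (gcd; gcd[m,n]∣m; gcd[m,n]∣n; gcd-greatest; c*gcd[m,n]≡gcd[cm,cn])
open import Data.Nat.Induction using (<-rec)
open import Data.Nat.Primality using (Prime; prime⇒nonTrivial; euclidsLemma; prime⇒irreducible)
open import Data.Nat.Properties
open import Algebra.Properties.CommutativeSemigroup *-commutativeSemigroup using (x∙yz≈y∙xz)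
open import Data.Product using (_×_; _,_; ∃-syntax; ∃₂)
open import Data.Product.Function.NonDependent.Propositional using (_×-⇔_)
open import Data.Sum using (inj₁; inj₂; [_,_]′)
open import Data.Unit using (tt)
open import Function using (_∘_)
open import Function.Bundles using (_⇔_; mk⇔; Equivalence)
open import Function.Construct.Composition using (_⇔-∘_)
open import Function.Construct.Identity using (⇔-id)
open import Function.Properties.Equivalence using (⇔-setoid)
open import Function.Related.TypeIsomorphisms using (¬-cong-⇔)
open import Level using (0ℓ)
open import Relation.Nullary using (¬_; yes; no)
open import Relation.Binary.Definitions using (tri<; tri≈; tri>)
open import Relation.Binary.PropositionalEquality
open import Relation.Binary.Reasoning.Setoid (⇔-setoid 0ℓ) as ⇔-Reasoning using ()

T-not : ∀ {b} → T (not b) ⇔ (¬ T b)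
T-not {false} = mk⇔ (λ _ ()) (λ _ → tt)
T-not {true}  = mk⇔ (λ ()) (λ ¬t → ¬t tt)

T-∧⁵ : ∀ {a b c d e} → T (a ∧ b ∧ c ∧ d ∧ e) ⇔ (T a × T b × T c × T d × T e)
T-∧⁵ = T-∧-cons (T-∧-cons (T-∧-cons T-∧))
  where
  T-∧-cons : ∀ {x y} {Y : Set} → T y ⇔ Y → T (x ∧ y) ⇔ (T x × Y)
  T-∧-cons y⇔Y = (⇔-id _ ×-⇔ y⇔Y) ⇔-∘ T-∧

≢⇒≡ᵇ≡false : ∀ {i j} → i ≢ j → (i ≡ᵇ j) ≡ false
≢⇒≡ᵇ≡false {i} {j} i≢j = Equivalence.to T-not-≡ (Equivalence.from T-not (i≢j ∘ ≡ᵇ⇒≡ i j))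

T-any-upTo : ∀ (q : ℕ → Bool) z → T (any q (upTo (suc z))) ⇔ (∃[ x ] x ≤ z × T (q x))
T-any-upTo q z = mk⇔
  (λ t → let x , x∈ , qx = find (any⁻ q _ t) in x , s≤s⁻¹ (∈-upTo⁻ x∈) , qx)
  (λ (x , x≤z , qx) → any⁺ q (lose (∈-upTo⁺ (s≤s x≤z)) qx))

ExpTriple : ℕ → ℕ → ℕ → Set
ExpTriple x y z = ∃[ n ] 1 < x × 1 < n × y ≡ x ^ n × z ≡ x ^ (n * n)

GeoTriple : ℕ → ℕ → ℕ → Set
GeoTriple a b c = ∃[ n ] 0 < a × 1 < n × b ≡ n * a × c ≡ n * n * a

Increasing : (ℕ → ℕ → ℕ → Set) → Set
Increasing R = ∀ {x y z} → R x y z → x < y × y < z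

Completes : (ℕ → ℕ → ℕ → Set) → (ℕ → Set) → ℕ → Set
Completes R S z = ∃₂ λ x y → R x y z × S x × S y

Completes-mono : ∀ {R S S′ z} → Increasing R → (∀ {i} → i < z → S i → S′ i) →
                 Completes R S z → Completes R S′ z
Completes-mono R-inc S⇒S′ (x , y , r , x∈S , y∈S) =
  let x<y , y<z = R-inc r in
  x , y , r , S⇒S′ (<-trans x<y y<z) x∈S , S⇒S′ y<z y∈S

*-positiveˡ : ∀ m {n} → 0 < m * n → 0 < m
*-positiveˡ m 0<mn = >-nonZero⁻¹ m {{m*n≢0⇒m≢0 m {{>-nonZero 0<mn}}}}

n<n*n : ∀ {n} → 1 < n → n < n * n
n<n*n {n@(suc _)} 1<n = m<m*n n n 1<n

n<m^n : ∀ {m} n → 1 < m → n < m ^ n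
n<m^n zero    1<m = z<s
n<m^n {m} (suc n) 1<m = begin-strict
  suc n      ≤⟨ n<m^n n 1<m ⟩
  m ^ n      <⟨ m<m*n (m ^ n) m 1<m ⟩
  m ^ n * m  ≡⟨ *-comm (m ^ n) m ⟩
  m ^ suc n  ∎
  where
  open ≤-Reasoning
  instance _ = >-nonZero (≤-trans (s≤s z≤n) (n<m^n n 1<m))

expTriple-increasing : Increasing ExpTriple
expTriple-increasing {x} (n , 1<x , 1<n , refl , refl) =
  subst (_< x ^ n) (^-identityʳ x) (^-monoʳ-< x 1<x 1<n) , ^-monoʳ-< x 1<x (n<n*n 1<n)

geoTriple-increasing : Increasing GeoTriple
geoTriple-increasing {a} (n , 0<a , 1<n , refl , refl) =
  subst (a <_) (*-comm a n) (m<m*n a n 1<n) , *-monoˡ-< a (n<n*n 1<n)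
  where instance _ = >-nonZero 0<a

T-expBlocked : ∀ f z → T (expBlocked f z) ⇔ Completes ExpTriple (T ∘ f) z
T-expBlocked f z = mk⇔ completion blocked
  where
  completion : T (expBlocked f z) → Completes ExpTriple (T ∘ f) z
  completion t =
    let x , _ , t′ = Equivalence.to (T-any-upTo _ z) t
        n , _ , t″ = Equivalence.to (T-any-upTo _ z) t′
        1<x , 1<n , z≡ , fx , fy = Equivalence.to T-∧⁵ t″
    in x , x ^ n , (n , ≤ᵇ⇒≤ 2 x 1<x , ≤ᵇ⇒≤ 2 n 1<n , refl , sym (≡ᵇ⇒≡ _ z z≡)) , fx , fy
  blocked : Completes ExpTriple (T ∘ f) z → T (expBlocked f z)
  blocked (x , y , r@(n , 1<x , 1<n , y≡ , z≡) , fx , fy) =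
    let x<y , y<z = expTriple-increasing r
        n<y = subst (n <_) (sym y≡) (n<m^n n 1<x)
    in Equivalence.from (T-any-upTo _ z) (x , <⇒≤ (<-trans x<y y<z) ,
         Equivalence.from (T-any-upTo _ z) (n , <⇒≤ (<-trans n<y y<z) ,
           Equivalence.from T-∧⁵ (≤⇒≤ᵇ 1<x , ≤⇒≤ᵇ 1<n , ≡⇒≡ᵇ _ _ (sym z≡) , fx , subst (T ∘ f) y≡ fy)))

T-geoBlocked : ∀ f z → T (geoBlocked f z) ⇔ Completes GeoTriple (T ∘ f) z
T-geoBlocked f z = mk⇔ completion blocked
  where
  completion : T (geoBlocked f z) → Completes GeoTriple (T ∘ f) z
  completion t =
    let a , _ , t′ = Equivalence.to (T-any-upTo _ z) t
        n , _ , t″ = Equivalence.to (T-any-upTo _ z) t′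
        0<a , 1<n , z≡ , fa , fb = Equivalence.to T-∧⁵ t″
    in a , n * a , (n , ≤ᵇ⇒≤ 1 a 0<a , ≤ᵇ⇒≤ 2 n 1<n , refl , sym (≡ᵇ⇒≡ _ z z≡)) , fa , fb
  blocked : Completes GeoTriple (T ∘ f) z → T (geoBlocked f z)
  blocked (a , b , r@(n , 0<a , 1<n , b≡ , z≡) , fa , fb) =
    let a<b , b<z = geoTriple-increasing r
        n≤b = subst (n ≤_) (sym b≡) (m≤m*n n a {{>-nonZero 0<a}})
    in Equivalence.from (T-any-upTo _ z) (a , <⇒≤ (<-trans a<b b<z) ,
         Equivalence.from (T-any-upTo _ z) (n , ≤-trans n≤b (<⇒≤ b<z) ,
           Equivalence.from T-∧⁵ (≤⇒≤ᵇ 0<a , ≤⇒≤ᵇ 1<n , ≡⇒≡ᵇ _ _ (sym z≡) , fa , subst (T ∘ f) b≡ fb)))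

InGreedy : ((ℕ → Bool) → ℕ → Bool) → ℕ → Set
InGreedy blocked i = T (greedy blocked (suc i) i)

greedy-below : ∀ blocked {i j} → i < j → greedy blocked j i ≡ greedy blocked (suc i) i
greedy-below blocked {i} {suc j} i<1+j with i ≟ j
... | yes refl = refl
... | no i≢j rewrite ≢⇒≡ᵇ≡false i≢j = greedy-below blocked (≤∧≢⇒< (s≤s⁻¹ i<1+j) i≢j)

greedy-last : ∀ blocked k → greedy blocked (suc (suc k)) (suc k) ≡ not (blocked (greedy blocked (suc k)) (suc k))
greedy-last blocked k rewrite Equivalence.to T-≡ (≡⇒≡ᵇ k k refl) = refl

module _ (blocked : (ℕ → Bool) → ℕ → Bool) {R : ℕ → ℕ → ℕ → Set} (R-increasing : Increasing R)
         (T-blocked : ∀ f z → T (blocked f z) ⇔ Completes R (T ∘ f) z) where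

  InGreedy⇔¬Completes : ∀ {k} → 0 < k → InGreedy blocked k ⇔ (¬ Completes R (InGreedy blocked) k)
  InGreedy⇔¬Completes {suc k} _ = begin
    InGreedy blocked (suc k)                                  ≡⟨ cong T (greedy-last blocked k) ⟩
    T (not (blocked (greedy blocked (suc k)) (suc k)))        ≈⟨ T-not ⟩
    (¬ T (blocked (greedy blocked (suc k)) (suc k)))          ≈⟨ ¬-cong-⇔ (T-blocked _ _) ⟩
    (¬ Completes R (T ∘ greedy blocked (suc k)) (suc k))      ≈⟨ ¬-cong-⇔ earlier-choices-agree ⟩
    (¬ Completes R (InGreedy blocked) (suc k))                ∎
    where
    open ⇔-Reasoning
    earlier-choices-agree : Completes R (T ∘ greedy blocked (suc k)) (suc k) ⇔ Completes R (InGreedy blocked) (suc k)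
    earlier-choices-agree = mk⇔
      (Completes-mono R-increasing λ i<k → subst T (greedy-below blocked i<k))
      (Completes-mono R-increasing λ i<k → subst T (sym (greedy-below blocked i<k)))

∈E₃*⇔¬Completes : ∀ {k} → 0 < k → k ∈E₃* ⇔ (¬ Completes ExpTriple _∈E₃* k)
∈E₃*⇔¬Completes = InGreedy⇔¬Completes expBlocked expTriple-increasing T-expBlocked

∈G₃*⇔¬Completes : ∀ {k} → 0 < k → k ∈G₃* ⇔ (¬ Completes GeoTriple _∈G₃* k)
∈G₃*⇔¬Completes = InGreedy⇔¬Completes geoBlocked geoTriple-increasing T-geoBlocked

-- Transfer along a power-compatible embedding

module PowerTransfer
  (K : ℕ → ℕ)
  (K-^ : ∀ c N → K c ^ N ≡ K (c * N))
  (K>1 : ∀ {e} → 0 < e → 1 < K e)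
  (K-root : ∀ {x N e} → 0 < x → 0 < N → x ^ N ≡ K e → ∃[ c ] c * N ≡ e × x ≡ K c)
  where

  K-*ˡ : ∀ c n → K c ^ n ≡ K (n * c)
  K-*ˡ c n = trans (K-^ c n) (cong K (*-comm c n))

  Completes-transfer : ∀ {e} → 0 < e → (∀ {c} → c < e → 0 < c → K c ∈E₃* ⇔ c ∈G₃*) →
                       Completes ExpTriple _∈E₃* (K e) ⇔ Completes GeoTriple _∈G₃* e
  Completes-transfer {e} 0<e K∈E⇔∈G = mk⇔ geometric exponential
    where
    geometric : Completes ExpTriple _∈E₃* (K e) → Completes GeoTriple _∈G₃* e
    geometric (x , y , (n , 1<x , 1<n , y≡ , Ke≡) , x∈ , y∈)
      with c , cn²≡e , refl ← K-root (<-trans z<s 1<x) (<-trans z<s (<-trans 1<n (n<n*n 1<n))) (sym Ke≡)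
      = let 0<c = *-positiveˡ c (subst (0 <_) (sym cn²≡e) 0<e)
            r = n , 0<c , 1<n , refl , trans (sym cn²≡e) (*-comm c (n * n))
            c<nc , nc<e = geoTriple-increasing r
        in c , n * c , r , Equivalence.to (K∈E⇔∈G (<-trans c<nc nc<e) 0<c) x∈ ,
           Equivalence.to (K∈E⇔∈G nc<e (<-trans 0<c c<nc)) (subst _∈E₃* (trans y≡ (K-*ˡ c n)) y∈)
    exponential : Completes GeoTriple _∈G₃* e → Completes ExpTriple _∈E₃* (K e)
    exponential (a , b , r@(n , 0<a , 1<n , b≡ , e≡) , a∈ , b∈) =
      let a<b , b<e = geoTriple-increasing r in
      K a , K b , (n , K>1 0<a , 1<n , Kb≡ , Ke≡) ,
      Equivalence.from (K∈E⇔∈G (<-trans a<b b<e) 0<a) a∈ , Equivalence.from (K∈E⇔∈G b<e (<-trans 0<a a<b)) b∈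
      where
      Kb≡ : K b ≡ K a ^ n
      Kb≡ = trans (cong K b≡) (sym (K-*ˡ a n))
      Ke≡ : K e ≡ K a ^ (n * n)
      Ke≡ = trans (cong K e≡) (sym (K-*ˡ a (n * n)))

  K∈E₃*⇔∈G₃* : ∀ e → 0 < e → K e ∈E₃* ⇔ e ∈G₃*
  K∈E₃*⇔∈G₃* = <-rec _ step
    where
    open ⇔-Reasoning
    step : ∀ e → (∀ {c} → c < e → 0 < c → K c ∈E₃* ⇔ c ∈G₃*) → 0 < e → K e ∈E₃* ⇔ e ∈G₃*
    step e K∈E⇔∈G 0<e = begin
      K e ∈E₃*                              ≈⟨ ∈E₃*⇔¬Completes (<-trans z<s (K>1 0<e)) ⟩
      (¬ Completes ExpTriple _∈E₃* (K e))   ≈⟨ ¬-cong-⇔ (Completes-transfer 0<e K∈E⇔∈G) ⟩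
      (¬ Completes GeoTriple _∈G₃* e)       ≈⟨ ∈G₃*⇔¬Completes 0<e ⟨
      e ∈G₃*                                ∎

-- Prime-power factors

^-distribʳ-* : ∀ m n o → (m * n) ^ o ≡ m ^ o * n ^ o
^-distribʳ-* m n zero    = refl
^-distribʳ-* m n (suc o) = begin
  m * n * (m * n) ^ o      ≡⟨ cong (m * n *_) (^-distribʳ-* m n o) ⟩
  m * n * (m ^ o * n ^ o)  ≡⟨ [m*n]*[o*p]≡[m*o]*[n*p] m n (m ^ o) (n ^ o) ⟩
  m ^ suc o * n ^ suc o    ∎
  where open ≡-Reasoning

^-cancelʳ-≡ : ∀ {m n o} → 0 < o → m ^ o ≡ n ^ o → m ≡ n
^-cancelʳ-≡ {m} {n} {o} 0<o eq with <-cmp m n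
... | tri< m<n _ _ = ⊥-elim (<⇒≢ (^-monoˡ-< o {{>-nonZero 0<o}} m<n) eq)
... | tri≈ _ m≡n _ = m≡n
... | tri> _ _ n<m = ⊥-elim (<⇒≢ (^-monoˡ-< o {{>-nonZero 0<o}} n<m) (sym eq))

prime>1 : ∀ {p} → Prime p → 1 < p
prime>1 {p} p-prime = nonTrivial⇒n>1 p {{prime⇒nonTrivial p-prime}}

prime∤1 : ∀ {p} → Prime p → p ∤ 1
prime∤1 p-prime p∣1 = <⇒≢ (prime>1 p-prime) (sym (∣1⇒≡1 p∣1))

prime∤* : ∀ {p m n} → Prime p → p ∤ m → p ∤ n → p ∤ m * n
prime∤* {m = m} {n} p-prime p∤m p∤n p∣mn = [ p∤m , p∤n ]′ (euclidsLemma m n p-prime p∣mn)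

prime∣^⇒∣ : ∀ {p m} n → Prime p → p ∣ m ^ n → p ∣ m
prime∣^⇒∣ zero          p-prime p∣1   = ⊥-elim (prime∤1 p-prime p∣1)
prime∣^⇒∣ {m = m} (suc n) p-prime p∣mmⁿ with euclidsLemma m (m ^ n) p-prime p∣mmⁿ
... | inj₁ p∣m  = p∣m
... | inj₂ p∣mⁿ = prime∣^⇒∣ n p-prime p∣mⁿ

prime∣prime⇒≡ : ∀ {q p} → Prime q → Prime p → q ∣ p → q ≡ p
prime∣prime⇒≡ q-prime p-prime q∣p with prime⇒irreducible p-prime q∣p
... | inj₁ q≡1 = ⊥-elim (<⇒≢ (prime>1 q-prime) (sym q≡1))
... | inj₂ q≡p = q≡p

prime-power-split : ∀ {p} → Prime p → ∀ y → 0 < y → ∃₂ λ v s → p ∤ s × y ≡ p ^ v * s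
prime-power-split {p} p-prime = <-rec _ split
  where
  split : ∀ y → (∀ {y′} → y′ < y → 0 < y′ → ∃₂ λ v s → p ∤ s × y′ ≡ p ^ v * s) →
          0 < y → ∃₂ λ v s → p ∤ s × y ≡ p ^ v * s
  split y rec 0<y with p ∣? y
  ... | no p∤y = 0 , y , p∤y , sym (*-identityˡ y)
  ... | yes (divides q refl) =
    let 0<q = *-positiveˡ q 0<y
        v , s , p∤s , q≡ = rec (m<m*n q p {{>-nonZero 0<q}} (prime>1 p-prime)) 0<q
    in suc v , s , p∤s , (begin
      q * p            ≡⟨ *-comm q p ⟩
      p * q            ≡⟨ cong (p *_) q≡ ⟩
      p * (p ^ v * s)  ≡⟨ *-assoc p (p ^ v) s ⟨
      p ^ suc v * s    ∎)
    where open ≡-Reasoning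

prime-power-split-unique : ∀ {p r s} → Prime p → p ∤ r → p ∤ s → ∀ a b → p ^ a * r ≡ p ^ b * s → a ≡ b
prime-power-split-unique _       _   _   zero    zero    _  = refl
prime-power-split-unique {p} {r} {s} _ p∤r _ zero (suc b) eq =
  ⊥-elim (p∤r (subst (p ∣_) (trans (sym eq) (*-identityˡ r)) (∣m⇒∣m*n s (m∣m*n (p ^ b)))))
prime-power-split-unique {p} {r} {s} _ _ p∤s (suc a) zero eq =
  ⊥-elim (p∤s (subst (p ∣_) (trans eq (*-identityˡ s)) (∣m⇒∣m*n r (m∣m*n (p ^ a)))))
prime-power-split-unique {p} {r} {s} p-prime p∤r p∤s (suc a) (suc b) eq =
  cong suc (prime-power-split-unique p-prime p∤r p∤s a b (*-cancelˡ-≡ _ _ p {{>-nonZero (<-trans z<s (prime>1 p-prime))}} (begin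
    p * (p ^ a * r)  ≡⟨ *-assoc p (p ^ a) r ⟨
    p ^ suc a * r    ≡⟨ eq ⟩
    p ^ suc b * s    ≡⟨ *-assoc p (p ^ b) s ⟩
    p * (p ^ b * s)  ∎)))
  where open ≡-Reasoning

prodFin-cong : ∀ n {f g : Fin n → ℕ} → (∀ i → f i ≡ g i) → prodFin n f ≡ prodFin n g
prodFin-cong zero    f≗g = refl
prodFin-cong (suc n) f≗g = cong₂ _*_ (f≗g zero) (prodFin-cong n (f≗g ∘ suc))

prodFin-^ : ∀ n (f : Fin n → ℕ) o → prodFin n f ^ o ≡ prodFin n (λ i → f i ^ o)
prodFin-^ zero    f o = ^-zeroˡ o
prodFin-^ (suc n) f o = trans (^-distribʳ-* (f zero) _ o) (cong (f zero ^ o *_) (prodFin-^ n (f ∘ suc) o))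

prodFin-positive : ∀ n (f : Fin n → ℕ) → (∀ i → 0 < f i) → 0 < prodFin n f
prodFin-positive zero    f f>0 = z<s
prodFin-positive (suc n) f f>0 = *-mono-≤ (f>0 zero) (prodFin-positive n (f ∘ suc) (f>0 ∘ suc))

prime∤prodFin : ∀ {n q} (p c : Fin n → ℕ) → Prime q → (∀ i → Prime (p i)) → (∀ i → q ≢ p i) →
                q ∤ prodFin n (λ i → p i ^ c i)
prime∤prodFin {zero}  p c q-prime p-prime q≢p = prime∤1 q-prime
prime∤prodFin {suc n} p c q-prime p-prime q≢p =
  prime∤* q-prime (q≢p zero ∘ prime∣prime⇒≡ q-prime (p-prime zero) ∘ prime∣^⇒∣ (c zero) q-prime)
    (prime∤prodFin (p ∘ suc) (c ∘ suc) q-prime (p-prime ∘ suc) (q≢p ∘ suc))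

prodFin-split : ∀ {n} (p c : Fin n → ℕ) → (∀ i → Prime (p i)) → (∀ i j → p i ≡ p j → i ≡ j) →
                ∀ j → ∃[ r ] p j ∤ r × prodFin n (λ i → p i ^ c i) ≡ p j ^ c j * r
prodFin-split {suc n} p c p-prime p-injective zero =
  prodFin n (λ i → p (suc i) ^ c (suc i)) ,
  prime∤prodFin (p ∘ suc) (c ∘ suc) (p-prime zero) (p-prime ∘ suc) (λ i → Fin-0≢1+n ∘ p-injective zero (suc i)) ,
  refl
prodFin-split {suc n} p c p-prime p-injective (suc j) =
  let r , p∤r , eq = prodFin-split (p ∘ suc) (c ∘ suc) (p-prime ∘ suc)
                       (λ i k → Fin-suc-injective ∘ p-injective (suc i) (suc k)) j
      p∤p₀ = λ p∣p₀ → Fin-0≢1+n (p-injective zero (suc j) (sym (prime∣prime⇒≡ (p-prime (suc j)) (p-prime zero) p∣p₀)))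
  in p zero ^ c zero * r ,
     prime∤* (p-prime (suc j)) (p∤p₀ ∘ prime∣^⇒∣ (c zero) (p-prime (suc j))) p∤r ,
     trans (cong (p zero ^ c zero *_) eq) (x∙yz≈y∙xz (p zero ^ c zero) (p (suc j) ^ c (suc j)) r)

perfect-power⇒∣exponents : ∀ {n} (p c : Fin n → ℕ) → (∀ i → Prime (p i)) → (∀ i j → p i ≡ p j → i ≡ j) →
                           ∀ {y N} → 0 < y → y ^ N ≡ prodFin n (λ i → p i ^ c i) → ∀ j → N ∣ c j
perfect-power⇒∣exponents p c p-prime p-injective {y} {N} 0<y yᴺ≡ j =
  let v , s , p∤s , y≡ = prime-power-split (p-prime j) y 0<y
      r , p∤r , prod≡ = prodFin-split p c p-prime p-injective j
      p∤sᴺ = p∤s ∘ prime∣^⇒∣ N (p-prime j)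
  in divides v (sym (prime-power-split-unique (p-prime j) p∤sᴺ p∤r (v * N) (c j) (begin
       p j ^ (v * N) * s ^ N   ≡⟨ cong (_* s ^ N) (^-*-assoc (p j) v N) ⟨
       (p j ^ v) ^ N * s ^ N   ≡⟨ ^-distribʳ-* (p j ^ v) s N ⟨
       (p j ^ v * s) ^ N       ≡⟨ cong (_^ N) y≡ ⟨
       y ^ N                   ≡⟨ yᴺ≡ ⟩
       prodFin _ (λ i → p i ^ c i) ≡⟨ prod≡ ⟩
       p j ^ c j * r           ∎)))
  where open ≡-Reasoning

gcdFin-∣ : ∀ n (f : Fin n → ℕ) i → gcdFin n f ∣ f i
gcdFin-∣ (suc n) f zero    = gcd[m,n]∣m (f zero) _
gcdFin-∣ (suc n) f (suc i) = ∣-trans (gcd[m,n]∣n (f zero) _) (gcdFin-∣ n (f ∘ suc) i)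

gcdFin-greatest : ∀ n (f : Fin n → ℕ) {d} → (∀ i → d ∣ f i) → d ∣ gcdFin n f
gcdFin-greatest zero    f d∣f = _ ∣0
gcdFin-greatest (suc n) f d∣f = gcd-greatest (d∣f zero) (gcdFin-greatest n (f ∘ suc) (d∣f ∘ suc))

gcdFin-cong : ∀ n {f g : Fin n → ℕ} → (∀ i → f i ≡ g i) → gcdFin n f ≡ gcdFin n g
gcdFin-cong zero    f≗g = refl
gcdFin-cong (suc n) f≗g = cong₂ gcd (f≗g zero) (gcdFin-cong n (f≗g ∘ suc))

gcdFin-*ˡ : ∀ n c (f : Fin n → ℕ) → gcdFin n (λ i → c * f i) ≡ c * gcdFin n f
gcdFin-*ˡ zero    c f = sym (*-zeroʳ c)
gcdFin-*ˡ (suc n) c f =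
  trans (cong (gcd (c * f zero)) (gcdFin-*ˡ n c (f ∘ suc))) (sym (c*gcd[m,n]≡gcd[cm,cn] c _ _))

gcdFin-positive : ∀ n (f : Fin n → ℕ) i → 0 < f i → 0 < gcdFin n f
gcdFin-positive n f i 0<fi =
  n≢0⇒n>0 λ g≡0 → m<n⇒n≢0 0<fi (0∣⇒≡0 (subst (_∣ f i) g≡0 (gcdFin-∣ n f i)))

gcdFin-cofactors : ∀ n (f q : Fin n → ℕ) → 0 < gcdFin n f → (∀ i → f i ≡ q i * gcdFin n f) → gcdFin n q ≡ 1
gcdFin-cofactors n f q 0<g f≡qg = *-cancelˡ-≡ _ _ g {{>-nonZero 0<g}} (begin
  g * gcdFin n q               ≡⟨ gcdFin-*ˡ n g q ⟨
  gcdFin n (λ i → g * q i)     ≡⟨ gcdFin-cong n (λ i → trans (*-comm g (q i)) (sym (f≡qg i))) ⟩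
  g                            ≡⟨ *-identityʳ g ⟨
  g * 1                        ∎)
  where
  g = gcdFin n f
  open ≡-Reasoning

-- Products of prime powers with coprime exponents

module CoprimeExponents {n} (p b : Fin (suc n) → ℕ) (p-prime : ∀ i → Prime (p i))
                        (p-injective : ∀ i j → p i ≡ p j → i ≡ j) (b>0 : ∀ i → 0 < b i)
                        (b-coprime : gcdFin (suc n) b ≡ 1) where

  K : ℕ → ℕ
  K e = prodFin (suc n) (λ i → p i ^ (b i * e))

  K-^ : ∀ c N → K c ^ N ≡ K (c * N)
  K-^ c N = trans (prodFin-^ (suc n) (λ i → p i ^ (b i * c)) N) (prodFin-cong (suc n) λ i →
    trans (^-*-assoc (p i) (b i * c) N) (cong (p i ^_) (*-assoc (b i) c N)))

  K>1 : ∀ {e} → 0 < e → 1 < K e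
  K>1 {e} 0<e = *-mono-≤ p₀≤p₀^b₀e (prodFin-positive n _ λ i → m^n>0 (p (suc i)) {{p≢0}} (b (suc i) * e))
    where
    p≢0 : ∀ {i} → NonZero (p i)
    p≢0 {i} = >-nonZero (<-trans z<s (prime>1 (p-prime i)))
    p₀≤p₀^b₀e : 2 ≤ p zero ^ (b zero * e)
    p₀≤p₀^b₀e = ≤-trans (prime>1 (p-prime zero))
      (subst (_≤ p zero ^ (b zero * e)) (^-identityʳ (p zero)) (^-monoʳ-≤ (p zero) {{p≢0}} (*-mono-≤ (b>0 zero) 0<e)))

  -- N divides every bᵢ e, hence their gcd e · gcd bᵢ = e.
  K-root : ∀ {x N e} → 0 < x → 0 < N → x ^ N ≡ K e → ∃[ c ] c * N ≡ e × x ≡ K c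
  K-root {x} {N} {e} 0<x 0<N xᴺ≡Ke =
    let divides c e≡cN = subst (N ∣_) e·gcd≡e
          (gcdFin-greatest (suc n) _ λ i → subst (N ∣_) (*-comm (b i) e) (N∣bᵢe i))
    in c , sym e≡cN , ^-cancelʳ-≡ 0<N (trans xᴺ≡Ke (trans (cong K e≡cN) (sym (K-^ c N))))
    where
    N∣bᵢe = perfect-power⇒∣exponents p (λ i → b i * e) p-prime p-injective 0<x xᴺ≡Ke
    e·gcd≡e : gcdFin (suc n) (λ i → e * b i) ≡ e
    e·gcd≡e = trans (gcdFin-*ˡ (suc n) e b) (trans (cong (e *_) b-coprime) (*-identityʳ e))

  open PowerTransfer K K-^ K>1 K-root public using (K∈E₃*⇔∈G₃*)

prodFin-∈E₃*⇔gcdFin-∈G₃* : ∀ {n} (p a : Fin (suc n) → ℕ) → (∀ i → Prime (p i)) → (∀ i j → p i ≡ p j → i ≡ j) →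
                           (∀ i → 0 < a i) → prodFin (suc n) (λ i → p i ^ a i) ∈E₃* ⇔ gcdFin (suc n) a ∈G₃*
prodFin-∈E₃*⇔gcdFin-∈G₃* {n} p a p-prime p-injective a>0 =
  subst (λ k → k ∈E₃* ⇔ g ∈G₃*) (prodFin-cong (suc n) λ i → cong (p i ^_) (sym (a≡bg i)))
    (K∈E₃*⇔∈G₃* g 0<g)
  where
  g = gcdFin (suc n) a
  0<g = gcdFin-positive (suc n) a zero (a>0 zero)
  b : Fin (suc n) → ℕ
  b i = quotient (gcdFin-∣ (suc n) a i)
  a≡bg : ∀ i → a i ≡ b i * g
  a≡bg i = _∣_.equality (gcdFin-∣ (suc n) a i)
  b>0 : ∀ i → 0 < b i
  b>0 i = *-positiveˡ (b i) (subst (0 <_) (a≡bg i) (a>0 i))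
  open CoprimeExponents p b p-prime p-injective b>0 (gcdFin-cofactors (suc n) a b 0<g a≡bg)

mainTheorem3 : (1 ∈E₃*)
    × ((n : ℕ) → 1 ≤ n → (p a : Fin n → ℕ) → (k : ℕ)
       → (∀ i → Prime (p i))
       → (∀ i j → p i ≡ p j → i ≡ j)
       → (∀ i → 1 ≤ a i)
       → k ≡ prodFin n (λ i → p i ^ a i)
       → (k ∈E₃* ⇔ gcdFin n a ∈G₃*))
mainTheorem3 = tt , λ where
  (suc n) _ p a _ p-prime p-injective a>0 refl → prodFin-∈E₃*⇔gcdFin-∈G₃* p a p-prime p-injective a>0
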